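{- Let $(\mu,k)$ be a marked partition of a positive integer $n$. Then there exists an integer $i\ge 0$ such that $\tau^{r}(\mu',1,k)\in U_n\setminus Q_n$ for all $0\le r<i$ (so that the iterates are defined) and $\tau^i(\mu',1,k)$ is a doubly marked partition of $n$.
   Context: Partitions are written with weakly decreasing positive parts $\lambda=(\lambda_1,\dots,\lambda_\ell)$; $\lambda'$ is the conjugate (so $\lambda'_s$ is the number of parts $\ge s$), $D(\lambda)$ is the side length of the Durfee square, and $s(\lambda)$ is the smallest part. A marked partition of $n$ is a pair $(\mu,k)$ with $\mu$ a partition of $n$ and $k$ an index with $\mu_k=s(\mu)$. A doubly marked partition of $n$ is a triple $(\lambda,s,t)$ with $|\lambda|=n$, $1\le s\le D(\lambda)$, $s\le t\le\lambda_1$, $\lambda'_s=\lambda'_t$; $Q_n$ denotes the set of these. Let $U_n=\{(\lambda,s,t): |\lambda|=n,\ 1\le s\le D(\lambda),\ 1\le t\le\lambda_1\}\supseteq Q_n$; note $(\mu',1,k)\in U_n$. The map $\tau$ on $U_n\setminus Q_n$ (i.e. triples in $U_n$ with $t<s$ or $\lambda'_s>\lambda'_t$): let $p$ be the maximum integer with $\lambda'_p=\lambda'_s$. Define $$\delta=(\lambda_1-p+s-1,\ \dots,\ \lambda_{\lambda'_s}-p+s-1,\ \lambda_{\lambda'_s+1},\ \dots,\ \lambda_\ell)$$ (discarding zero parts, and with $\delta_i=0$ beyond its length). Let $a$ be the minimum integer such that $\delta_a<\lambda'_s$, and let $\mu^*=(\delta_1,\dots,\delta_{a-1},\lambda'_s,\lambda'_{s+1},\dots,\lambda'_p,\delta_a,\delta_{a+1},\dots)$,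 i.e. $\delta$ with $p-s+1$ parts equal to $\lambda'_s$ inserted. If $t<s$ set $b=t$; if $\lambda'_s>\lambda'_t$ set $b=t-p+s-1$. Then $\tau(\lambda,s,t)=(\mu^*,a,b)$, which lies in $U_n$. -}

module Defs where

open import Data.Nat using (ℕ; zero; suc; _+_; _∸_; _≤_; _<_; _≥_; _≤?_; _<?_; _≟_; _⊔_)
open import Data.List using (List; []; _∷_; length; filter; map; upTo; take; drop; takeWhile; replicate; _++_; foldr)
open import Data.Nat.ListAction using (sum)
open import Data.List.Relation.Unary.All using (All)
open import Data.List.Relation.Unary.Linked using (Linked)
open import Data.Product using (_×_; _,_)
open import Relation.Nullary using (¬_)
open import Relation.Nullary.Decidable using (⌊_⌋)
open import Data.Bool using (if_then_else_)

IsPartition : List ℕ → Set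
IsPartition l = All (0 <_) l × Linked _≥_ l

-- 1-indexed part λ_i, with λ_i = 0 beyond the length (and λ_0 := 0 by convention).
part : List ℕ → ℕ → ℕ
part []       _             = 0
part (x ∷ xs) zero          = 0
part (x ∷ xs) (suc zero)    = x
part (x ∷ xs) (suc (suc i)) = part xs (suc i)

largest : List ℕ → ℕ
largest l = part l 1

smallest : List ℕ → ℕ
smallest l = part l (length l)

range : ℕ → ℕ → List ℕ
range a b = map (a +_) (upTo (suc b ∸ a))

conjPart : List ℕ → ℕ → ℕ
conjPart l s = length (filter (λ x → s ≤? x) l)

conj : List ℕ → List ℕ
conj l = map (conjPart l) (range 1 (largest l))

durfee : List ℕ → ℕ
durfee l = length (filter (λ i → i ≤? part l i) (range 1 (length l)))

Triple : Set
Triple = List ℕ × ℕ × ℕ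

InU : ℕ → Triple → Set
InU n (l , s , t) = IsPartition l × sum l ≡ n × 1 ≤ s × s ≤ durfee l × 1 ≤ t × t ≤ largest l
  where open import Relation.Binary.PropositionalEquality using (_≡_)

InQ : ℕ → Triple → Set
InQ n (l , s , t) = InU n (l , s , t) × s ≤ t × conjPart l s ≡ conjPart l t
  where open import Relation.Binary.PropositionalEquality using (_≡_)

InUminusQ : ℕ → Triple → Set
InUminusQ n x = InU n x × ¬ InQ n x

IsMarked : ℕ → List ℕ → ℕ → Set
IsMarked n μ k = IsPartition μ × sum μ ≡ n × 1 ≤ k × k ≤ length μ × part μ k ≡ smallest μ
  where open import Relation.Binary.PropositionalEquality using (_≡_)

-- The map τ (only meaningful on U_n \ Q_n; total function otherwise arbitrary).
module Tau (l : List ℕ) (s t : ℕ) where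
  c : ℕ
  c = conjPart l s
  p : ℕ
  p = foldr _⊔_ 0 (filter (λ q → conjPart l q ≟ c) (range 1 (largest l)))
  d : ℕ
  d = p ∸ s + 1
  δ : List ℕ
  δ = filter (λ x → 0 <? x) (map (λ x → x ∸ d) (take c l) ++ drop c l)
  a : ℕ
  a = suc (length (takeWhile (λ x → c ≤? x) δ))
  μ* : List ℕ
  μ* = take (a ∸ 1) δ ++ replicate d c ++ drop (a ∸ 1) δ
  b : ℕ
  b = if ⌊ t <? s ⌋ then t else t ∸ d

τ : Triple → Triple
τ (l , s , t) = μ* , a , b
  where open Tau l s t

iter : (Triple → Triple) → ℕ → Triple → Triple
iter f zero    x = x
iter f (suc r) x = f (iter f r x)

module Submission where

-- Let (λ, s, t) ∈ U_n ∖ Q_n, c = λ'_s and p the last column of height c.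
-- Since s is in the Durfee square, c ≥ s; the top c rows of λ are ≥ p and the others
-- are < s, so shortening the top rows by d = p − s + 1 gives a partition δ, and
-- inserting d parts equal to c restores the size n.  Maximality of p shows that fewer
-- than c parts of δ are ≥ c, which puts a in the Durfee square of μ*.  If t < s then
-- b = t and μ* has more parts than λ; if s ≤ t then λ'_t ≠ λ'_s forces t > p and
-- b = t − d < t.  So t · (n + 1) + (n − ℓ(λ)) strictly decreases along τ.

open import Defs
open import Data.Nat
open import Data.Nat.Properties
open import Data.List using (List; []; _∷_; length; filter; map; upTo; take; drop; takeWhile; replicate; _++_; foldr; applyUpTo)
open import Data.List.Properties
  using (filter-accept; filter-reject; filter-all; filter-none; filter-++; length-filter; length-++; length-map;
         length-take; length-replicate; length-upTo; take++drop≡id; map-++; map-cong; map-applyUpTo; upTo-∷ʳ)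
open import Data.List.Membership.Propositional using (_∈_)
open import Data.List.Membership.Propositional.Properties using (∈-map⁺; ∈-upTo⁺; ∈-filter⁺; ∈-filter⁻)
open import Data.List.Relation.Unary.Any using (here; there)
open import Data.List.Relation.Unary.All using (All; []; _∷_)
import Data.List.Relation.Unary.All as All
import Data.List.Relation.Unary.All.Properties as AllP
open import Data.List.Relation.Unary.AllPairs using (AllPairs; []; _∷_)
import Data.List.Relation.Unary.AllPairs as AllPairs
import Data.List.Relation.Unary.AllPairs.Properties as AllPairsP
open import Data.List.Relation.Unary.Linked.Properties using (AllPairs⇒Linked; Linked⇒AllPairs)
open import Data.List.Relation.Binary.Sublist.Propositional using (_⊆_; ⊆-reflexive; _∷ʳ_)
open import Data.List.Relation.Binary.Sublist.Propositional.Properties using (filter⁺; filter-⊆; take-⊆; length-mono-≤)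
open import Data.Nat.ListAction using (sum)
open import Data.Nat.ListAction.Properties using (sum-++)
open import Data.Nat.Induction using (<-wellFounded)
open import Induction.WellFounded using (Acc; acc)
open import Algebra.Properties.CommutativeSemigroup +-commutativeSemigroup using (interchange; xy∙z≈xz∙y)
open import Data.Product using (_×_; _,_; proj₁; proj₂; ∃-syntax)
open import Data.Sum using (_⊎_; inj₁; inj₂)
open import Data.Empty using (⊥-elim)
open import Relation.Nullary using (¬_; Dec; yes; no)
open import Relation.Unary using (Pred; Decidable)
open import Level using (0ℓ)
open import Relation.Binary.PropositionalEquality
  using (_≡_; _≢_; refl; sym; trans; cong; cong₂; subst; subst₂; module ≡-Reasoning)

-- A weakly decreasing list.  `IsPartition` records this as `Linked _≥_`;
-- the all-pairs form is the one the list library reasons with.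
Sorted : List ℕ → Set
Sorted = AllPairs _≥_

partition-sorted : ∀ {l} → IsPartition l → Sorted l
partition-sorted (_ , linked) = Linked⇒AllPairs (λ x≥y y≥z → ≤-trans y≥z x≥y) linked

conjPart-≥ : ∀ {x q} xs → q ≤ x → conjPart (x ∷ xs) q ≡ suc (conjPart xs q)
conjPart-≥ {q = q} xs q≤x = cong length (filter-accept (q ≤?_) q≤x)

conjPart-< : ∀ {x q} xs → ¬ q ≤ x → conjPart (x ∷ xs) q ≡ conjPart xs q
conjPart-< {q = q} xs q≰x = cong length (filter-reject (q ≤?_) q≰x)

conjPart-++ : ∀ q xs ys → conjPart (xs ++ ys) q ≡ conjPart xs q + conjPart ys q
conjPart-++ q xs ys = trans (cong length (filter-++ (q ≤?_) xs ys)) (length-++ (filter (q ≤?_) xs))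

conjPart-≤-length : ∀ q xs → conjPart xs q ≤ length xs
conjPart-≤-length q xs = length-filter (q ≤?_) xs

conjPart-all : ∀ {q xs} → All (q ≤_) xs → conjPart xs q ≡ length xs
conjPart-all {q} all = cong length (filter-all (q ≤?_) all)

conjPart-none : ∀ {q xs} → All (_< q) xs → conjPart xs q ≡ 0
conjPart-none {q} all = cong length (filter-none (q ≤?_) (All.map <⇒≱ all))

conjPart-⊆ : ∀ q {xs ys} → xs ⊆ ys → conjPart xs q ≤ conjPart ys q
conjPart-⊆ q xs⊆ys = length-mono-≤ (filter⁺ (q ≤?_) (q ≤?_) (λ { refl h → h }) xs⊆ys)

conjPart-antitone : ∀ {q q'} xs → q ≤ q' → conjPart xs q' ≤ conjPart xs q
conjPart-antitone {q} {q'} xs q≤q' =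
  length-mono-≤ (filter⁺ (q' ≤?_) (q ≤?_) (λ { refl h → ≤-trans q≤q' h }) (⊆-reflexive {x = xs} refl))

conjPart-map : ∀ (f : ℕ → ℕ) {c q} → (∀ {x} → c ≤ f x → q ≤ x) →
  ∀ xs → conjPart (map f xs) c ≤ conjPart xs q
conjPart-map f {c} {q} reflect [] = z≤n
conjPart-map f {c} {q} reflect (x ∷ xs) with c ≤? f x
... | yes c≤fx rewrite conjPart-≥ (map f xs) c≤fx | conjPart-≥ xs (reflect c≤fx) =
  s≤s (conjPart-map f reflect xs)
... | no c≰fx rewrite conjPart-< (map f xs) c≰fx =
  ≤-trans (conjPart-map f reflect xs) (conjPart-⊆ q (x ∷ʳ ⊆-reflexive refl))

all-<-trans : ∀ {x q xs} → x < q → All (_≤ x) xs → All (_< q) xs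
all-<-trans x<q = All.map (λ y≤x → ≤-<-trans y≤x x<q)

split-at-conjPart : ∀ q xs → Sorted xs →
  All (q ≤_) (take (conjPart xs q) xs) × All (_< q) (drop (conjPart xs q) xs)
split-at-conjPart q [] _ = [] , []
split-at-conjPart q (x ∷ xs) (x≥xs ∷ sorted) with q ≤? x
... | yes q≤x rewrite conjPart-≥ xs q≤x =
  let (big , small) = split-at-conjPart q xs sorted in (q≤x ∷ big) , small
... | no q≰x rewrite conjPart-< xs q≰x | conjPart-none (all-<-trans (≰⇒> q≰x) x≥xs) =
  [] , (≰⇒> q≰x ∷ all-<-trans (≰⇒> q≰x) x≥xs)

all-≤-largest : ∀ xs → Sorted xs → All (_≤ largest xs) xs
all-≤-largest [] _ = []
all-≤-largest (x ∷ xs) (x≥xs ∷ _) = ≤-refl ∷ x≥xs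

part-∈-or-zero : ∀ {P : ℕ → Set} xs i → P 0 → All P xs → P (part xs i)
part-∈-or-zero [] i p0 _ = p0
part-∈-or-zero (x ∷ xs) zero p0 _ = p0
part-∈-or-zero (x ∷ xs) (suc zero) p0 (px ∷ _) = px
part-∈-or-zero (x ∷ xs) (suc (suc i)) p0 (_ ∷ pxs) = part-∈-or-zero xs (suc i) p0 pxs

part-≤-largest : ∀ xs i → Sorted xs → part xs i ≤ largest xs
part-≤-largest xs i sorted = part-∈-or-zero xs i z≤n (all-≤-largest xs sorted)

part-antitone : ∀ xs {i j} → Sorted xs → 1 ≤ i → i ≤ j → part xs j ≤ part xs i
part-antitone [] _ _ _ = z≤n
part-antitone (x ∷ xs) {suc zero} {j} sorted _ _ = part-≤-largest (x ∷ xs) j sorted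
part-antitone (x ∷ xs) {suc (suc i)} {suc (suc j)} (_ ∷ sorted) _ (s≤s i≤j) =
  part-antitone xs sorted (s≤s z≤n) i≤j

galois : ∀ xs {i q} → Sorted xs → 1 ≤ i → 1 ≤ q → q ≤ part xs i → i ≤ conjPart xs q
galois [] {suc i} _ _ 1≤q q≤0 with () ← ≤-trans 1≤q q≤0
galois (x ∷ xs) {suc zero} _ _ _ q≤x rewrite conjPart-≥ xs q≤x = s≤s z≤n
galois (x ∷ xs) {suc (suc i)} (x≥xs ∷ sorted) _ 1≤q q≤λi
  rewrite conjPart-≥ xs (≤-trans q≤λi (part-∈-or-zero xs (suc i) z≤n x≥xs)) =
  s≤s (galois xs sorted (s≤s z≤n) 1≤q q≤λi)

conjPart-pos⇒≤largest : ∀ xs q → Sorted xs → 1 ≤ conjPart xs q → q ≤ largest xs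
conjPart-pos⇒≤largest xs q sorted 1≤λ'q with q ≤? largest xs
... | yes q≤λ1 = q≤λ1
... | no q≰λ1 with () ← subst (1 ≤_) (conjPart-none (all-<-trans (≰⇒> q≰λ1) (all-≤-largest xs sorted))) 1≤λ'q

part-after-prefix : ∀ (xs : List ℕ) y ys → part (xs ++ y ∷ ys) (suc (length xs)) ≡ y
part-after-prefix [] y ys = refl
part-after-prefix (x ∷ []) y ys = refl
part-after-prefix (x ∷ x' ∷ xs) y ys = part-after-prefix (x' ∷ xs) y ys

part-pos⇒≤length : ∀ xs i → 0 < part xs i → i ≤ length xs
part-pos⇒≤length (x ∷ xs) zero _ = z≤n
part-pos⇒≤length (x ∷ xs) (suc zero) _ = s≤s z≤n
part-pos⇒≤length (x ∷ xs) (suc (suc i)) pos = s≤s (part-pos⇒≤length xs (suc i) pos)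

range-snoc : ∀ m → range 1 (suc m) ≡ range 1 m ++ suc m ∷ []
range-snoc m = trans (cong (map suc) (sym (upTo-∷ʳ m))) (map-++ suc (upTo m) (m ∷ []))

∈-range : ∀ {m q} → 1 ≤ q → q ≤ m → q ∈ range 1 m
∈-range {q = suc q} _ q<m = ∈-map⁺ suc (∈-upTo⁺ q<m)

module Count {P : Pred ℕ 0ℓ} (P? : Decidable P) where

  count : ℕ → ℕ
  count m = length (filter P? (range 1 m))

  count-suc : ∀ m → count (suc m) ≡ count m + length (filter P? (suc m ∷ []))
  count-suc m = trans (cong (λ r → length (filter P? r)) (range-snoc m))
                      (trans (cong length (filter-++ P? (range 1 m) (suc m ∷ [])))
                             (length-++ (filter P? (range 1 m))))

  count-≤ : ∀ m → count m ≤ m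
  count-≤ m = ≤-trans (length-filter P? (range 1 m))
                      (≤-reflexive (trans (length-map suc (upTo m)) (length-upTo m)))

  count-mono : ∀ {m m'} → m ≤ m' → count m ≤ count m'
  count-mono {m} {zero} z≤n = ≤-refl
  count-mono {m} {suc m'} m≤1+m' with m≤n⇒m<n∨m≡n m≤1+m'
  ... | inj₂ refl = ≤-refl
  ... | inj₁ (s≤s m≤m') rewrite count-suc m' = ≤-trans (count-mono m≤m') (m≤m+n _ _)

  count-all : ∀ m → (∀ i → 1 ≤ i → i ≤ m → P i) → m ≤ count m
  count-all zero _ = z≤n
  count-all (suc m) all
    rewrite count-suc m | filter-accept P? {suc m} {[]} (all (suc m) (s≤s z≤n) ≤-refl) =
    ≤-trans (≤-reflexive (+-comm 1 m))
            (+-monoˡ-≤ 1 (count-all m (λ i 1≤i i≤m → all i 1≤i (m≤n⇒m≤1+n i≤m))))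

  count-none : ∀ {s} m → 1 ≤ s → (∀ i → s ≤ i → ¬ P i) → count m < s
  count-none zero 1≤s _ = 1≤s
  count-none {s} (suc m) 1≤s none with s ≤? suc m
  ... | yes s≤1+m rewrite count-suc m | filter-reject P? {suc m} {[]} (none (suc m) s≤1+m) =
    ≤-trans (s≤s (≤-reflexive (+-identityʳ _))) (count-none m 1≤s none)
  ... | no s≰1+m = ≤-<-trans (count-≤ (suc m)) (≰⇒> s≰1+m)

-- For a sorted list the Durfee side D(λ) is characterised by: s ≤ D(λ) ⟺ s ≤ λ_s
-- (for s ≥ 1), since the indices i with i ≤ λ_i form an initial segment.
module _ (l : List ℕ) (sorted : Sorted l) where
  open Count (λ i → i ≤? part l i)

  durfee⇒diagonal : ∀ {s} → 1 ≤ s → s ≤ durfee l → s ≤ part l s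
  durfee⇒diagonal {s} 1≤s s≤D with s ≤? part l s
  ... | yes s≤λs = s≤λs
  ... | no s≰λs = ⊥-elim (<⇒≱ (count-none (length l) 1≤s beyond) s≤D)
    where
      beyond : ∀ i → s ≤ i → ¬ i ≤ part l i
      beyond i s≤i i≤λi = s≰λs (≤-trans s≤i (≤-trans i≤λi (part-antitone l sorted 1≤s s≤i)))

  diagonal⇒durfee : ∀ {a} → 1 ≤ a → a ≤ part l a → a ≤ durfee l
  diagonal⇒durfee {a} 1≤a a≤λa =
    ≤-trans (count-all a below) (count-mono (part-pos⇒≤length l a (≤-trans 1≤a a≤λa)))
    where
      below : ∀ i → 1 ≤ i → i ≤ a → i ≤ part l i
      below i 1≤i i≤a = ≤-trans i≤a (≤-trans a≤λa (part-antitone l sorted 1≤i i≤a))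

≤-maximum : ∀ {x} xs → x ∈ xs → x ≤ foldr _⊔_ 0 xs
≤-maximum (y ∷ ys) (here refl) = m≤m⊔n y (foldr _⊔_ 0 ys)
≤-maximum (y ∷ ys) (there x∈ys) = ≤-trans (≤-maximum ys x∈ys) (m≤n⊔m y (foldr _⊔_ 0 ys))

maximum-∈ : ∀ {x} xs → x ∈ xs → foldr _⊔_ 0 xs ∈ xs
maximum-∈ (y ∷ ys) _ = cons y ys
  where
    cons : ∀ y ys → foldr _⊔_ 0 (y ∷ ys) ∈ y ∷ ys
    cons y [] = subst (_∈ y ∷ []) (sym (⊔-identityʳ y)) (here refl)
    cons y (z ∷ zs) with ⊔-sel y (foldr _⊔_ 0 (z ∷ zs))
    ... | inj₁ max≡y = subst (_∈ y ∷ z ∷ zs) (sym max≡y) (here refl)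
    ... | inj₂ max≡rest = subst (_∈ y ∷ z ∷ zs) (sym max≡rest) (there (cons z zs))

all-pairs-across : ∀ {c xs ys} → All (c ≤_) xs → All (_≤ c) ys → All (λ x → All (x ≥_) ys) xs
all-pairs-across big small = All.map (λ c≤x → All.map (λ y≤c → ≤-trans y≤c c≤x) small) big

replicate-all : ∀ {P : ℕ → Set} d {c} → P c → All P (replicate d c)
replicate-all zero _ = []
replicate-all (suc d) pc = pc ∷ replicate-all d pc

replicate-sorted : ∀ d c → Sorted (replicate d c)
replicate-sorted zero c = []
replicate-sorted (suc d) c = replicate-all d ≤-refl ∷ replicate-sorted d c

sum-replicate : ∀ d c → sum (replicate d c) ≡ d * c
sum-replicate zero c = refl
sum-replicate (suc d) c = cong (c +_) (sum-replicate d c)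

splice-additive : (h : List ℕ → ℕ) → (∀ xs ys → h (xs ++ ys) ≡ h xs + h ys) →
  ∀ J xs R → h (take J xs ++ R ++ drop J xs) ≡ h xs + h R
splice-additive h h-++ J xs R = begin
  h (take J xs ++ R ++ drop J xs)         ≡⟨ h-++ (take J xs) (R ++ drop J xs) ⟩
  h (take J xs) + h (R ++ drop J xs)      ≡⟨ cong (h (take J xs) +_) (trans (h-++ R (drop J xs)) (+-comm (h R) _)) ⟩
  h (take J xs) + (h (drop J xs) + h R)   ≡⟨ sym (+-assoc (h (take J xs)) _ _) ⟩
  (h (take J xs) + h (drop J xs)) + h R   ≡⟨ cong (_+ h R) (sym (h-++ (take J xs) (drop J xs))) ⟩
  h (take J xs ++ drop J xs) + h R        ≡⟨ cong (λ ys → h ys + h R) (take++drop≡id J xs) ⟩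
  h xs + h R                              ∎
  where open ≡-Reasoning

-- Insert a block of d parts equal to c into a sorted list, right after its λ'_c
-- parts that are ≥ c; this is how τ rebuilds μ* from δ.
insertBlock : List ℕ → ℕ → ℕ → List ℕ
insertBlock xs d c = take (conjPart xs c) xs ++ replicate d c ++ drop (conjPart xs c) xs

module _ (xs : List ℕ) (d c : ℕ) where
  private
    J : ℕ
    J = conjPart xs c

  insertBlock-sorted : Sorted xs → Sorted (insertBlock xs d c)
  insertBlock-sorted sorted =
    AllPairsP.++⁺ (AllPairsP.take⁺ J sorted)
      (AllPairsP.++⁺ (replicate-sorted d c) (AllPairsP.drop⁺ J sorted)
        (all-pairs-across (replicate-all d ≤-refl) small))
      (all-pairs-across big (AllP.++⁺ (replicate-all d ≤-refl) small))
    where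
      big : All (c ≤_) (take J xs)
      big = proj₁ (split-at-conjPart c xs sorted)
      small : All (_≤ c) (drop J xs)
      small = All.map <⇒≤ (proj₂ (split-at-conjPart c xs sorted))

  insertBlock-positive : All (0 <_) xs → 1 ≤ c → All (0 <_) (insertBlock xs d c)
  insertBlock-positive pos 1≤c = AllP.++⁺ (AllP.take⁺ J pos) (AllP.++⁺ (replicate-all d 1≤c) (AllP.drop⁺ J pos))

  insertBlock-sum : sum (insertBlock xs d c) ≡ sum xs + d * c
  insertBlock-sum = trans (splice-additive sum sum-++ J xs (replicate d c)) (cong (sum xs +_) (sum-replicate d c))

  insertBlock-length : length (insertBlock xs d c) ≡ length xs + d
  insertBlock-length =
    trans (splice-additive length (λ ys zs → length-++ ys) J xs (replicate d c)) (cong (length xs +_) (length-replicate d))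

  insertBlock-part : 1 ≤ d → part (insertBlock xs d c) (suc J) ≡ c
  insertBlock-part (s≤s {n = d'} _) =
    subst (λ j → part (insertBlock xs d c) (suc j) ≡ c) length-prefix
          (part-after-prefix (take J xs) c (replicate d' c ++ drop J xs))
    where
      length-prefix : length (take J xs) ≡ J
      length-prefix = trans (length-take J xs) (m≤n⇒m⊓n≡m (conjPart-≤-length c xs))

insertBlock-largest : ∀ xs d c → Sorted xs → 1 ≤ d → largest xs ≤ largest (insertBlock xs d c)
insertBlock-largest [] d c _ _ = z≤n
insertBlock-largest (y ∷ ys) (suc d) c (y≥ys ∷ _) _ with c ≤? y
... | yes c≤y rewrite conjPart-≥ ys c≤y = ≤-refl
... | no c≰y rewrite conjPart-< ys c≰y | conjPart-none (all-<-trans (≰⇒> c≰y) y≥ys) = <⇒≤ (≰⇒> c≰y)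

takeWhile≡filter : ∀ {P : Pred ℕ 0ℓ} (P? : Decidable P) xs →
  AllPairs (λ x y → ¬ P x → ¬ P y) xs → takeWhile P? xs ≡ filter P? xs
takeWhile≡filter P? [] _ = refl
takeWhile≡filter P? (x ∷ xs) (inherit ∷ later) with P? x
... | yes _ = cong (x ∷_) (takeWhile≡filter P? xs later)
... | no ¬px = sym (filter-none P? (All.map (λ fails → fails ¬px) inherit))

length-takeWhile-sorted : ∀ c xs → Sorted xs → length (takeWhile (c ≤?_) xs) ≡ conjPart xs c
length-takeWhile-sorted c xs sorted =
  cong length (takeWhile≡filter (c ≤?_) xs (AllPairs.map (λ y≤x c≰x c≤y → c≰x (≤-trans c≤y y≤x)) sorted))

sum-drop-zeros : ∀ xs → sum (filter (0 <?_) xs) ≡ sum xs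
sum-drop-zeros [] = refl
sum-drop-zeros (zero ∷ xs) = sum-drop-zeros xs
sum-drop-zeros (suc x ∷ xs) = cong (suc x +_) (sum-drop-zeros xs)

sum-lower : ∀ d xs → All (d ≤_) xs → sum xs ≡ sum (map (_∸ d) xs) + length xs * d
sum-lower d [] _ = refl
sum-lower d (x ∷ xs) (d≤x ∷ d≤xs) = begin
  x + sum xs                                              ≡⟨ cong₂ _+_ (sym (m∸n+n≡m d≤x)) (sum-lower d xs d≤xs) ⟩
  (x ∸ d + d) + (sum (map (_∸ d) xs) + length xs * d)    ≡⟨ interchange (x ∸ d) d _ _ ⟩
  (x ∸ d + sum (map (_∸ d) xs)) + (d + length xs * d)    ∎
  where open ≡-Reasoning

length≤sum : ∀ l → All (0 <_) l → length l ≤ sum l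
length≤sum [] _ = z≤n
length≤sum (x ∷ l) (1≤x ∷ positive) = +-mono-≤ 1≤x (length≤sum l positive)

conjPart-singleton-sum : ∀ x L → sum (map (conjPart (x ∷ [])) (range 1 L)) ≡ L ⊓ x
conjPart-singleton-sum x zero = refl
conjPart-singleton-sum x (suc L) = begin
  sum (map indicator (range 1 (suc L)))
    ≡⟨ cong (λ r → sum (map indicator r)) (range-snoc L) ⟩
  sum (map indicator (range 1 L ++ suc L ∷ []))
    ≡⟨ cong sum (map-++ indicator (range 1 L) (suc L ∷ [])) ⟩
  sum (map indicator (range 1 L) ++ indicator (suc L) ∷ [])
    ≡⟨ sum-++ (map indicator (range 1 L)) (indicator (suc L) ∷ []) ⟩
  sum (map indicator (range 1 L)) + (indicator (suc L) + 0)
    ≡⟨ cong₂ _+_ (conjPart-singleton-sum x L) (+-identityʳ _) ⟩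
  L ⊓ x + indicator (suc L)
    ≡⟨ last-step ⟩
  suc L ⊓ x ∎
  where
    open ≡-Reasoning
    indicator : ℕ → ℕ
    indicator = conjPart (x ∷ [])
    last-step : L ⊓ x + indicator (suc L) ≡ suc L ⊓ x
    last-step with suc L ≤? x
    ... | yes L<x rewrite conjPart-≥ [] L<x | m≤n⇒m⊓n≡m (<⇒≤ L<x) | m≤n⇒m⊓n≡m L<x = +-comm L 1
    ... | no L≮x
      rewrite conjPart-< [] L≮x | m≥n⇒m⊓n≡n (≤-pred (≰⇒> L≮x))
            | m≥n⇒m⊓n≡n (<⇒≤ (≰⇒> L≮x)) = +-identityʳ x

sum-map-+ : ∀ (f g : ℕ → ℕ) zs → sum (map (λ q → f q + g q) zs) ≡ sum (map f zs) + sum (map g zs)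
sum-map-+ f g [] = refl
sum-map-+ f g (z ∷ zs) = trans (cong (f z + g z +_) (sum-map-+ f g zs)) (interchange (f z) (g z) _ _)

sum-zeros : ∀ zs → sum (map (conjPart []) zs) ≡ 0
sum-zeros [] = refl
sum-zeros (z ∷ zs) = sum-zeros zs

conjPart-sum : ∀ L xs → All (_≤ L) xs → sum (map (conjPart xs) (range 1 L)) ≡ sum xs
conjPart-sum L [] _ = sum-zeros (range 1 L)
conjPart-sum L (x ∷ xs) (x≤L ∷ xs≤L) = begin
  sum (map (conjPart (x ∷ xs)) (range 1 L))
    ≡⟨ cong sum (map-cong (λ q → conjPart-++ q (x ∷ []) xs) (range 1 L)) ⟩
  sum (map (λ q → conjPart (x ∷ []) q + conjPart xs q) (range 1 L))
    ≡⟨ sum-map-+ (conjPart (x ∷ [])) (conjPart xs) (range 1 L) ⟩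
  sum (map (conjPart (x ∷ [])) (range 1 L)) + sum (map (conjPart xs) (range 1 L))
    ≡⟨ cong₂ _+_ (trans (conjPart-singleton-sum x L) (m≥n⇒m⊓n≡n x≤L)) (conjPart-sum L xs xs≤L) ⟩
  x + sum xs ∎
  where open ≡-Reasoning

module Conjugate (μ : List ℕ) (partition : IsPartition μ) where
  private
    sorted : Sorted μ
    sorted = partition-sorted partition
    column : ℕ → ℕ
    column i = conjPart μ (suc i)

  conj-applyUpTo : conj μ ≡ applyUpTo column (largest μ)
  conj-applyUpTo = trans (cong (map (conjPart μ)) (map-applyUpTo (λ i → i) suc (largest μ)))
                         (map-applyUpTo suc (conjPart μ) (largest μ))

  conj-sorted : Sorted (conj μ)
  conj-sorted = subst Sorted (sym conj-applyUpTo)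
    (AllPairsP.applyUpTo⁺₁ column (largest μ) (λ i<j _ → conjPart-antitone μ (s≤s (<⇒≤ i<j))))

  conj-partition : IsPartition (conj μ)
  conj-partition = positive , AllPairs⇒Linked conj-sorted
    where
      positive : All (0 <_) (conj μ)
      positive = subst (All (0 <_)) (sym conj-applyUpTo)
        (AllP.applyUpTo⁺₁ column (largest μ) (λ i<λ1 → galois μ sorted (s≤s z≤n) (s≤s z≤n) i<λ1))

  conj-sum : sum (conj μ) ≡ sum μ
  conj-sum = conjPart-sum (largest μ) μ (all-≤-largest μ sorted)

conj-largest : ∀ μ → All (0 <_) μ → largest (conj μ) ≡ length μ
conj-largest [] _ = refl
conj-largest (zero ∷ xs) (() ∷ _)
conj-largest (suc x ∷ xs) positive = conjPart-all positive

start-in-U : ∀ n μ k → IsMarked n μ k → InU n (conj μ , 1 , k)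
start-in-U n μ k (partition , sum≡n , 1≤k , k≤ℓ , _) =
  conj-partition , trans conj-sum sum≡n , ≤-refl , 1≤D , 1≤k , k≤λ'₁
  where
    open Conjugate μ partition
    k≤λ'₁ : k ≤ largest (conj μ)
    k≤λ'₁ = subst (k ≤_) (sym (conj-largest μ (proj₁ partition))) k≤ℓ
    1≤D : 1 ≤ durfee (conj μ)
    1≤D = diagonal⇒durfee (conj μ) conj-sorted ≤-refl (≤-trans 1≤k k≤λ'₁)

<⇒≤∸1 : ∀ {m n} → m < n → m ≤ n ∸ 1
<⇒≤∸1 {n = suc n} (s≤s m≤n) = m≤n

module BlockWidth {s p : ℕ} (1≤s : 1 ≤ s) (s≤p : s ≤ p) where
  private
    d : ℕ
    d = p ∸ s + 1

  s+d≡1+p : s + d ≡ suc p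
  s+d≡1+p = trans (sym (+-assoc s (p ∸ s) 1)) (trans (cong (_+ 1) (m+[n∸m]≡n s≤p)) (+-comm p 1))

  s-1+d≡p : s ∸ 1 + d ≡ p
  s-1+d≡p = suc-injective (trans (cong (_+ d) (trans (+-comm 1 (s ∸ 1)) (m∸n+n≡m 1≤s))) s+d≡1+p)

  1≤d : 1 ≤ d
  1≤d = m≤n+m 1 (p ∸ s)

  d≤row : ∀ {x} → p ≤ x → d ≤ x
  d≤row p≤x = m+n≤o⇒n≤o (s ∸ 1) (subst (_≤ _) (sym s-1+d≡p) p≤x)

  lower-row : ∀ {x} → p ≤ x → s ∸ 1 ≤ x ∸ d
  lower-row p≤x = m+n≤o⇒m≤o∸n (s ∸ 1) (subst (_≤ _) (sym s-1+d≡p) p≤x)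

  lower-past-p : ∀ {x} → p < x → s ≤ x ∸ d
  lower-past-p {x} p<x = m+n≤o⇒m≤o∸n s (subst (_≤ x) (sym s+d≡1+p) p<x)

  lowered-big⇒past-p : ∀ {x} → s ≤ x ∸ d → p < x
  lowered-big⇒past-p {x} s≤x-d with d ≤? x
  ... | yes d≤x = subst (_≤ x) s+d≡1+p (m≤o∸n⇒m+n≤o s d≤x s≤x-d)
  ... | no d≰x with () ← ≤-trans 1≤s (subst (s ≤_) (m≤n⇒m∸n≡0 (<⇒≤ (≰⇒> d≰x))) s≤x-d)

largest-lower-head : ∀ d c l → 1 ≤ c →
  largest l ∸ d ≤ largest (filter (0 <?_) (map (_∸ d) (take c l) ++ drop c l))
largest-lower-head d (suc c) [] _ = ≤-reflexive (0∸n≡0 d)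
largest-lower-head d (suc c) (x ∷ xs) _ = head-survives (x ∸ d) (map (_∸ d) (take c xs) ++ drop c xs)
  where
    head-survives : ∀ z zs → z ≤ largest (filter (0 <?_) (z ∷ zs))
    head-survives zero zs = z≤n
    head-survives (suc z) zs = ≤-reflexive (cong largest (sym (filter-accept (0 <?_) {xs = zs} (s≤s z≤n))))

module TauStep {n l s t} (partition : IsPartition l) (sum≡n : sum l ≡ n)
               (1≤s : 1 ≤ s) (s≤D : s ≤ durfee l) (1≤t : 1 ≤ t) (t≤λ₁ : t ≤ largest l) where
  open Tau l s t public

  sorted : Sorted l
  sorted = partition-sorted partition

  -- s lies in the Durfee square, so column s has height c ≥ s.
  s≤λs : s ≤ part l s
  s≤λs = durfee⇒diagonal l sorted 1≤s s≤D

  s≤c : s ≤ c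
  s≤c = galois l sorted 1≤s 1≤s s≤λs

  1≤c : 1 ≤ c
  1≤c = ≤-trans 1≤s s≤c

  s≤λ₁ : s ≤ largest l
  s≤λ₁ = ≤-trans s≤λs (part-≤-largest l s sorted)

  columns-of-height-c : List ℕ
  columns-of-height-c = filter (λ q → conjPart l q ≟ c) (range 1 (largest l))

  height-c⇒∈ : ∀ {q} → 1 ≤ q → q ≤ largest l → conjPart l q ≡ c → q ∈ columns-of-height-c
  height-c⇒∈ 1≤q q≤λ₁ height = ∈-filter⁺ (λ q → conjPart l q ≟ c) (∈-range 1≤q q≤λ₁) height

  height-c⇒≤p : ∀ {q} → 1 ≤ q → q ≤ largest l → conjPart l q ≡ c → q ≤ p
  height-c⇒≤p 1≤q q≤λ₁ height = ≤-maximum columns-of-height-c (height-c⇒∈ 1≤q q≤λ₁ height)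

  s≤p : s ≤ p
  s≤p = height-c⇒≤p 1≤s s≤λ₁ refl

  λ'p≡c : conjPart l p ≡ c
  λ'p≡c = proj₂ (∈-filter⁻ (λ q → conjPart l q ≟ c) {xs = range 1 (largest l)}
                           (maximum-∈ columns-of-height-c (height-c⇒∈ 1≤s s≤λ₁ refl)))

  -- By maximality of p, column p + 1 is strictly shorter than c.
  λ'[1+p]<c : conjPart l (suc p) < c
  λ'[1+p]<c = ≤∧≢⇒< (≤-trans (conjPart-antitone l (n≤1+n p)) (≤-reflexive λ'p≡c)) shorter
    where
      shorter : conjPart l (suc p) ≢ c
      shorter height = n≮n p (height-c⇒≤p (s≤s z≤n)
        (conjPart-pos⇒≤largest l (suc p) sorted (subst (1 ≤_) (sym height) 1≤c)) height)

  open BlockWidth 1≤s s≤p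

  top bottom : List ℕ
  top = take c l
  bottom = drop c l

  top≥p : All (p ≤_) top
  top≥p = subst (λ j → All (p ≤_) (take j l)) λ'p≡c (proj₁ (split-at-conjPart p l sorted))

  bottom<s : All (_< s) bottom
  bottom<s = proj₂ (split-at-conjPart s l sorted)

  length-top : length top ≡ c
  length-top = trans (length-take c l) (m≤n⇒m⊓n≡m (conjPart-≤-length s l))

  lowered ys : List ℕ
  lowered = map (_∸ d) top
  ys = lowered ++ bottom

  lowered≥s-1 : All (s ∸ 1 ≤_) lowered
  lowered≥s-1 = AllP.map⁺ (All.map lower-row top≥p)

  ys-sorted : Sorted ys
  ys-sorted = AllPairsP.++⁺ (AllPairsP.map⁺ (AllPairs.map (∸-monoˡ-≤ d) (AllPairsP.take⁺ c sorted)))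
                            (AllPairsP.drop⁺ c sorted)
                            (all-pairs-across lowered≥s-1 (All.map <⇒≤∸1 bottom<s))

  δ-sorted : Sorted δ
  δ-sorted = AllPairsP.filter⁺ (0 <?_) ys-sorted

  δ-positive : All (0 <_) δ
  δ-positive = AllP.all-filter (0 <?_) ys

  -- The removed cells are exactly the inserted block: |δ| + d·c = n.
  δ-sum : sum δ + d * c ≡ n
  δ-sum = begin
    sum δ + d * c                              ≡⟨ cong (_+ d * c) (trans (sum-drop-zeros ys) (sum-++ lowered bottom)) ⟩
    (sum lowered + sum bottom) + d * c         ≡⟨ xy∙z≈xz∙y (sum lowered) (sum bottom) (d * c) ⟩
    (sum lowered + d * c) + sum bottom         ≡⟨ cong (λ m → sum lowered + m + sum bottom) block≡removed ⟩
    (sum lowered + length top * d) + sum bottom ≡⟨ cong (_+ sum bottom) (sym (sum-lower d top (All.map d≤row top≥p))) ⟩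
    sum top + sum bottom                       ≡⟨ sym (sum-++ top bottom) ⟩
    sum (top ++ bottom)                        ≡⟨ cong sum (take++drop≡id c l) ⟩
    sum l                                      ≡⟨ sum≡n ⟩
    n                                          ∎
    where
      open ≡-Reasoning
      block≡removed : d * c ≡ length top * d
      block≡removed = trans (*-comm d c) (cong (_* d) (sym length-top))

  -- Fewer than c parts of δ are ≥ c: such a part comes from a row longer than p.
  J : ℕ
  J = conjPart δ c

  J<c : J < c
  J<c = begin-strict
    conjPart δ c                             ≤⟨ conjPart-⊆ c (filter-⊆ (0 <?_) ys) ⟩
    conjPart ys c                            ≡⟨ conjPart-++ c lowered bottom ⟩
    conjPart lowered c + conjPart bottom c   ≡⟨ cong (conjPart lowered c +_) bottom-small ⟩
    conjPart lowered c + 0                   ≡⟨ +-identityʳ _ ⟩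
    conjPart lowered c                       ≤⟨ conjPart-map (_∸ d) big⇒past-p top ⟩
    conjPart top (suc p)                     ≤⟨ conjPart-⊆ (suc p) (take-⊆ c l) ⟩
    conjPart l (suc p)                       <⟨ λ'[1+p]<c ⟩
    c                                        ∎
    where
      open ≤-Reasoning
      bottom-small : conjPart bottom c ≡ 0
      bottom-small = conjPart-none (All.map (λ y<s → <-≤-trans y<s s≤c) bottom<s)
      big⇒past-p : ∀ {x} → c ≤ x ∸ d → suc p ≤ x
      big⇒past-p c≤x-d = lowered-big⇒past-p (≤-trans s≤c c≤x-d)

  μ*≡insertBlock : μ* ≡ insertBlock δ d c
  μ*≡insertBlock = cong (λ j → take j δ ++ replicate d c ++ drop j δ) (length-takeWhile-sorted c δ δ-sorted)

  a≡1+J : a ≡ suc J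
  a≡1+J = cong suc (length-takeWhile-sorted c δ δ-sorted)

  μ*-sorted : Sorted μ*
  μ*-sorted = subst Sorted (sym μ*≡insertBlock) (insertBlock-sorted δ d c δ-sorted)

  μ*-partition : IsPartition μ*
  μ*-partition = subst IsPartition (sym μ*≡insertBlock)
    (insertBlock-positive δ d c δ-positive 1≤c , AllPairs⇒Linked (insertBlock-sorted δ d c δ-sorted))

  μ*-sum : sum μ* ≡ n
  μ*-sum = trans (cong sum μ*≡insertBlock) (trans (insertBlock-sum δ d c) δ-sum)

  -- The part at position a of μ* is c > J, so a lies in the Durfee square of μ*.
  μ*-part-a : part μ* a ≡ c
  μ*-part-a = subst₂ (λ m i → part m i ≡ c) (sym μ*≡insertBlock) (sym a≡1+J) (insertBlock-part δ d c 1≤d)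

  a≤D : a ≤ durfee μ*
  a≤D = diagonal⇒durfee μ* μ*-sorted (subst (1 ≤_) (sym a≡1+J) (s≤s z≤n))
          (subst₂ _≤_ (sym a≡1+J) (sym μ*-part-a) J<c)

  c≤λ₁* : c ≤ largest μ*
  c≤λ₁* = subst (_≤ largest μ*) μ*-part-a (part-≤-largest μ* a μ*-sorted)

  -- Case t < s: b = t, and since s ≥ 2 no row of δ vanishes, so μ* gains d parts.
  b≡t : t < s → b ≡ t
  b≡t t<s with t <? s
  ... | yes _ = refl
  ... | no t≮s = ⊥-elim (t≮s t<s)

  more-parts : 2 ≤ s → length l < length μ*
  more-parts 2≤s = begin-strict
    length l                     <⟨ m<m+n (length l) 1≤d ⟩
    length l + d                 ≡⟨ cong (_+ d) (sym length-δ) ⟩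
    length δ + d                 ≡⟨ sym (insertBlock-length δ d c) ⟩
    length (insertBlock δ d c)   ≡⟨ cong length (sym μ*≡insertBlock) ⟩
    length μ*                    ∎
    where
      open ≤-Reasoning
      ys-positive : All (0 <_) ys
      ys-positive = AllP.++⁺ (All.map (≤-trans (<⇒≤∸1 2≤s)) lowered≥s-1) (AllP.drop⁺ c (proj₁ partition))
      length-δ : length δ ≡ length l
      length-δ = begin-equality
        length δ                           ≡⟨ cong length (filter-all (0 <?_) ys-positive) ⟩
        length ys                          ≡⟨ length-++ lowered ⟩
        length lowered + length bottom     ≡⟨ cong (_+ length bottom) (length-map (_∸ d) top) ⟩
        length top + length bottom         ≡⟨ sym (length-++ top) ⟩
        length (top ++ bottom)             ≡⟨ cong length (take++drop≡id c l) ⟩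
        length l                           ∎

  b≡t-d : ¬ t < s → b ≡ t ∸ d
  b≡t-d t≮s with t <? s
  ... | yes t<s = ⊥-elim (t≮s t<s)
  ... | no _ = refl

  past-p : s ≤ t → conjPart l t ≢ c → p < t
  past-p s≤t λ't≢c with p <? t
  ... | yes p<t = p<t
  ... | no p≮t = ⊥-elim (λ't≢c (≤-antisym (conjPart-antitone l s≤t)
                                           (≤-trans (≤-reflexive (sym λ'p≡c)) (conjPart-antitone l (≮⇒≥ p≮t)))))

  lowered-t≤λ₁* : t ∸ d ≤ largest μ*
  lowered-t≤λ₁* = begin
    t ∸ d                        ≤⟨ ∸-monoˡ-≤ d t≤λ₁ ⟩
    largest l ∸ d                ≤⟨ largest-lower-head d c l 1≤c ⟩
    largest δ                    ≤⟨ insertBlock-largest δ d c δ-sorted 1≤d ⟩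
    largest (insertBlock δ d c)  ≡⟨ cong largest (sym μ*≡insertBlock) ⟩
    largest μ*                   ∎
    where open ≤-Reasoning

  -- μ* and a always meet the conditions of U_n; only the bounds on b depend on the case.
  μ*-a-in-U : ∀ {b'} → 1 ≤ b' → b' ≤ largest μ* → InU n (μ* , a , b')
  μ*-a-in-U 1≤b' b'≤λ₁* = μ*-partition , μ*-sum , s≤s z≤n , a≤D , 1≤b' , b'≤λ₁*

  Progress : Set
  Progress = (b ≡ t × length l < length μ*) ⊎ b < t

  τ-step : ¬ (s ≤ t × c ≡ conjPart l t) → InU n (μ* , a , b) × Progress
  τ-step ¬Q = by-cases (t <? s)
    where
      by-cases : Dec (t < s) → InU n (μ* , a , b) × Progress
      by-cases (yes t<s) =
        μ*-a-in-U (subst (1 ≤_) (sym b≡t') 1≤t) (subst (_≤ largest μ*) (sym b≡t') t≤λ₁*) ,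
        inj₁ (b≡t' , more-parts (≤-trans (s≤s 1≤t) t<s))
        where
          b≡t' : b ≡ t
          b≡t' = b≡t t<s
          t≤λ₁* : t ≤ largest μ*
          t≤λ₁* = ≤-trans (<⇒≤ (<-≤-trans t<s s≤c)) c≤λ₁*
      by-cases (no t≮s) =
        μ*-a-in-U (subst (1 ≤_) (sym b≡t-d') (≤-trans 1≤s (lower-past-p p<t)))
                  (subst (_≤ largest μ*) (sym b≡t-d') lowered-t≤λ₁*) ,
        inj₂ (subst (_< t) (sym b≡t-d') (∸-monoʳ-< 1≤d (d≤row (<⇒≤ p<t))))
        where
          b≡t-d' : b ≡ t ∸ d
          b≡t-d' = b≡t-d t≮s
          s≤t : s ≤ t
          s≤t = ≮⇒≥ t≮s
          p<t : p < t
          p<t = past-p s≤t (λ λ't≡c → ¬Q (s≤t , sym λ't≡c))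

iter-shift : ∀ (f : Triple → Triple) r x → iter f (suc r) x ≡ iter f r (f x)
iter-shift f zero x = refl
iter-shift f (suc r) x = cong f (iter-shift f r x)

module Iteration (f : Triple → Triple) (Dom Stop : Triple → Set) (measure : Triple → ℕ)
                 (stop? : ∀ x → Dom x → Dec (Stop x))
                 (step : ∀ x → Dom x → ¬ Stop x → Dom (f x) × measure (f x) < measure x) where

  Reaches : Triple → Set
  Reaches x = ∃[ i ] ((∀ r → r < i → Dom (iter f r x) × ¬ Stop (iter f r x)) × Stop (iter f i x))

  reaches-acc : ∀ x → Acc _<_ (measure x) → Dom x → Reaches x
  reaches-acc x (acc smaller) dom with stop? x dom
  ... | yes stop = 0 , (λ _ ()) , stop
  ... | no ¬stop with reaches-acc (f x) (smaller (proj₂ (step x dom ¬stop))) (proj₁ (step x dom ¬stop))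
  ...   | i , later , stops = suc i , before , subst Stop (sym (iter-shift f i x)) stops
    where
      before : ∀ r → r < suc i → Dom (iter f r x) × ¬ Stop (iter f r x)
      before zero _ = dom , ¬stop
      before (suc r) (s≤s r<i) = subst (λ y → Dom y × ¬ Stop y) (sym (iter-shift f r x)) (later r r<i)

  reaches : ∀ x → Dom x → Reaches x
  reaches x = reaches-acc x (<-wellFounded (measure x))

-- Along τ either t drops, or t stays and the number of parts grows (it never
-- exceeds n); so t · (n + 1) + (n − ℓ(λ)) strictly decreases.
measure : ℕ → Triple → ℕ
measure n (l , s , t) = t * suc n + (n ∸ length l)

measure-decreases : ∀ n l l' s s' t b → length l' ≤ n → ((b ≡ t × length l < length l') ⊎ b < t) →
  measure n (l' , s' , b) < measure n (l , s , t)
measure-decreases n l l' s s' t b l'≤n (inj₁ (refl , more)) = +-monoʳ-< (b * suc n) (∸-monoʳ-< more l'≤n)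
measure-decreases n l l' s s' t b l'≤n (inj₂ b<t) = begin-strict
  b * suc n + (n ∸ length l')     ≤⟨ +-monoʳ-≤ (b * suc n) (m∸n≤m n (length l')) ⟩
  b * suc n + n                   <⟨ +-monoʳ-< (b * suc n) (n<1+n n) ⟩
  b * suc n + suc n               ≡⟨ +-comm (b * suc n) (suc n) ⟩
  suc b * suc n                   ≤⟨ *-monoˡ-≤ (suc n) b<t ⟩
  t * suc n                       ≤⟨ m≤m+n (t * suc n) (n ∸ length l) ⟩
  t * suc n + (n ∸ length l)      ∎
  where open ≤-Reasoning

Q? : ∀ n T → InU n T → Dec (InQ n T)
Q? n (l , s , t) hU with s ≤? t | conjPart l s ≟ conjPart l t
... | yes s≤t | yes same = yes (hU , s≤t , same)
... | no s≰t  | _        = no (λ (_ , s≤t , _) → s≰t s≤t)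
... | yes _   | no differ = no (λ (_ , _ , same) → differ same)

τ-decreases : ∀ n T → InU n T → ¬ InQ n T → InU n (τ T) × measure n (τ T) < measure n T
τ-decreases n (l , s , t) hU@(partition , sum≡n , 1≤s , s≤D , 1≤t , t≤λ₁) ¬Q =
  proj₁ step , measure-decreases n l μ* s a t b ℓ*≤n (proj₂ step)
  where
    open TauStep partition sum≡n 1≤s s≤D 1≤t t≤λ₁
    step : InU n (μ* , a , b) × Progress
    step = τ-step (λ (s≤t , same) → ¬Q (hU , s≤t , same))
    ℓ*≤n : length μ* ≤ n
    ℓ*≤n = subst (length μ* ≤_) μ*-sum (length≤sum μ* (proj₁ μ*-partition))

-- The theorem: start in U_n (start-in-U) and apply the termination principle to τ.
lemma3p4 : (n : ℕ) (μ : List ℕ) (k : ℕ) → 0 < n → IsMarked n μ k →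
    ∃[ i ] ((∀ r → r < i → InUminusQ n (iter τ r (conj μ , 1 , k)))
    × InQ n (iter τ i (conj μ , 1 , k)))
lemma3p4 n μ k _ marked = reaches (conj μ , 1 , k) (start-in-U n μ k marked)
  where open Iteration τ (InU n) (InQ n) (measure n) (Q? n) (τ-decreases n)
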